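{- For all non-negative integers $n$ and $m$, $$ \sum_{0\le i\le j} j\binom {2n}{n+i}\binom {2m}{m+j} =\frac {m} {4}\binom {2n+2m} {n+m}+m\binom {2n}n\binom {2m-2}{m-2} -\frac {m} {8}\sum_{\ell=0} ^{n-m}\binom {2n-2\ell}{n-\ell}\binom {2m+2\ell} {m+\ell} +\frac {m} {2}\sum_{\ell=0} ^{n-m+1}\binom {2n-2\ell}{n-\ell}\binom {2m+2\ell-2} {m+\ell-1}, $$ where the left sum runs over all pairs of integers $(i,j)$ with $0\le i\le j$.
   Context: Binomial coefficients: for integers $a,b$, $\binom ab=a(a-1)\cdots(a-b+1)/b!$ if $b\ge0$ and $\binom ab=0$ if $b<0$. Sums with possibly "reversed" limits are interpreted as follows: for integers $M,N$, $\sum_{k=M}^{N-1}E(k)$ equals the usual sum if $N>M$, equals $0$ if $N=M$, and equals $-\sum_{k=N}^{M-1}E(k)$ if $N<M$. -}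

module Defs where

open import Data.Nat.Base as ℕ using (ℕ; zero; suc; _!)
open import Data.Nat.Properties using (_!≢0)
open import Data.Integer.Base using (ℤ; +_; -[1+_]; _+_; _*_; -_; _-_; _/ℕ_; 0ℤ; 1ℤ)

fall : ℤ → ℕ → ℤ
fall a zero    = 1ℤ
fall a (suc b) = fall a b * (a - + b)

binom : ℤ → ℤ → ℤ
binom a (+ b)    = _/ℕ_ (fall a b) (b !) {{b !≢0}}
binom a -[1+ _ ] = 0ℤ

sumFrom : ℤ → ℕ → (ℤ → ℤ) → ℤ
sumFrom M zero    f = 0ℤ
sumFrom M (suc k) f = sumFrom M k f + f (M + + k)

-- Σ_{k=M}^{N-1} f k with the paper's convention for reversed limits:
--   usual sum if N > M, 0 if N = M, and - Σ_{k=N}^{M-1} f k if N < M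
sumZ : ℤ → ℤ → (ℤ → ℤ) → ℤ
sumZ M N f with N - M
... | + k      = sumFrom M k f
... | -[1+ k ] = - sumFrom N (suc k) f

module Submission where

open import Defs
open import Data.Nat.Base using (ℕ)
open import Data.Integer.Base using (ℤ; +_; _+_; _*_; _-_)
open import Relation.Binary.PropositionalEquality using (_≡_)

open import Data.Nat.Base as ℕ using (zero; suc; _!; _<_; s≤s)
import Data.Nat.Properties as ℕₚ
open import Data.Nat.Properties using (_!≢0)
open import Data.Nat.Combinatorics using (_C_; nCk+nC[k+1]≡[n+1]C[k+1]; nC1≡n; nCk≡nC[n∸k]; k>n⇒nCk≡0)
open import Data.Nat.DivMod using (m*n/n≡m)
import Data.Nat.Tactic.RingSolver as ℕ-Solver
open import Data.Integer.Base using (-[1+_]; -_; _/ℕ_; 0ℤ; 1ℤ; -1ℤ)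
import Data.Integer.Properties as ℤₚ
open import Data.Integer.Tactic.RingSolver using (solve-∀)
open import Relation.Nullary using (yes; no)
open import Relation.Binary.PropositionalEquality using (refl; sym; trans; cong; cong₂; subst; module ≡-Reasoning)
open ≡-Reasoning

-- Write m = k + 1.  Absorption and Pascal's rule give j·C(2m, m+j) = m·(C(2k+1, k+j) − C(2k+1, k+j+1)),
-- so summation by parts turns the double sum into m times the cross sum Σ_{0≤i≤m} C(2n, n+i)·C(2k+1, k+i).
-- Expanding C(2n+2, ·) and C(2k+3, ·) by Pascal's rule twice, the difference of the cross sums at (n+1, k)
-- and (n, k+1) telescopes to a boundary term, and the right-hand side divided by m changes by the same
-- amount along that diagonal.  Induction on k therefore reduces the identity to k = 0, where it comes down
-- to Σ_l C(2l, l)·C(2n−2l, n−l) = 4ⁿ; that convolution satisfies T(n+1) = 4·T(n), as one sees by computing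
-- Σ_l l·C(2l, l)·C(2n−2l, n−l) once via the reflection l ↦ n − l and once via (l+1)·C(2l+2, l+1) = 2(2l+1)·C(2l, l).

choose : ℕ → ℤ → ℤ
choose n (+ k)    = + (n C k)
choose n -[1+ _ ] = 0ℤ

[k+1]*[n+1]C[k+1]≡[n+1]*nCk : ∀ n k → suc k ℕ.* (suc n C suc k) ≡ suc n ℕ.* (n C k)
[k+1]*[n+1]C[k+1]≡[n+1]*nCk n       zero    =
  trans (ℕₚ.*-identityˡ (suc n C 1)) (trans (nC1≡n (suc n)) (sym (ℕₚ.*-identityʳ (suc n))))
[k+1]*[n+1]C[k+1]≡[n+1]*nCk zero    (suc k) = ℕₚ.*-zeroʳ (suc (suc k))
[k+1]*[n+1]C[k+1]≡[n+1]*nCk (suc n) (suc k) = begin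
  suc (suc k) ℕ.* (suc (suc n) C suc (suc k))       ≡⟨ cong (suc (suc k) ℕ.*_) (sym (nCk+nC[k+1]≡[n+1]C[k+1] (suc n) (suc k))) ⟩
  suc (suc k) ℕ.* (x ℕ.+ y)                         ≡⟨ rearrange k x y ⟩
  x ℕ.+ suc k ℕ.* x ℕ.+ suc (suc k) ℕ.* y           ≡⟨ cong₂ (λ u v → x ℕ.+ u ℕ.+ v)
                                                         ([k+1]*[n+1]C[k+1]≡[n+1]*nCk n k)
                                                         ([k+1]*[n+1]C[k+1]≡[n+1]*nCk n (suc k)) ⟩
  x ℕ.+ suc n ℕ.* (n C k) ℕ.+ suc n ℕ.* (n C suc k) ≡⟨ ℕₚ.+-assoc x _ _ ⟩
  x ℕ.+ (suc n ℕ.* (n C k) ℕ.+ suc n ℕ.* (n C suc k)) ≡⟨ cong (x ℕ.+_) (sym (ℕₚ.*-distribˡ-+ (suc n) (n C k) _)) ⟩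
  x ℕ.+ suc n ℕ.* (n C k ℕ.+ n C suc k)             ≡⟨ cong (λ u → x ℕ.+ suc n ℕ.* u) (nCk+nC[k+1]≡[n+1]C[k+1] n k) ⟩
  suc (suc n) ℕ.* x                                 ∎
  where
  x = suc n C suc k
  y = suc n C suc (suc k)
  rearrange : ∀ k x y → suc (suc k) ℕ.* (x ℕ.+ y) ≡ x ℕ.+ suc k ℕ.* x ℕ.+ suc (suc k) ℕ.* y
  rearrange = ℕ-Solver.solve-∀

fall-suc : ∀ a k → fall (1ℤ + a) (suc k) ≡ (1ℤ + a) * fall a k
fall-suc a zero    = base a
  where
  base : ∀ a → 1ℤ * ((1ℤ + a) - + 0) ≡ (1ℤ + a) * 1ℤ
  base = solve-∀
fall-suc a (suc k) = begin
  fall (1ℤ + a) (suc k) * ((1ℤ + a) - + suc k) ≡⟨ cong (_* ((1ℤ + a) - + suc k)) (fall-suc a k) ⟩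
  (1ℤ + a) * fall a k * ((1ℤ + a) - (1ℤ + + k)) ≡⟨ step a (fall a k) (+ k) ⟩
  (1ℤ + a) * (fall a k * (a - + k))             ∎
  where
  step : ∀ a F K → (1ℤ + a) * F * ((1ℤ + a) - (1ℤ + K)) ≡ (1ℤ + a) * (F * (a - K))
  step = solve-∀

fall-0 : ∀ k → fall 0ℤ (suc k) ≡ 0ℤ
fall-0 zero    = refl
fall-0 (suc k) = cong (_* (0ℤ - + suc k)) (fall-0 k)

fall≡nCk*k! : ∀ n k → fall (+ n) k ≡ + ((n C k) ℕ.* k !)
fall≡nCk*k! n       zero    = refl
fall≡nCk*k! zero    (suc k) = fall-0 k
fall≡nCk*k! (suc n) (suc k) = begin
  fall (+ suc n) (suc k)                          ≡⟨ fall-suc (+ n) k ⟩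
  + suc n * F                                     ≡⟨ split F (+ n) (+ k) ⟩
  fall (+ n) (suc k) + + suc k * F                ≡⟨ cong₂ (λ u v → u + + suc k * v) (fall≡nCk*k! n (suc k)) (fall≡nCk*k! n k) ⟩
  + ((n C suc k) ℕ.* suc k !) + + suc k * + ((n C k) ℕ.* k !)
    ≡⟨ cong (λ v → + ((n C suc k) ℕ.* suc k !) + v) (sym (ℤₚ.pos-* (suc k) _)) ⟩
  + ((n C suc k) ℕ.* suc k ! ℕ.+ suc k ℕ.* ((n C k) ℕ.* k !))
    ≡⟨ cong +_ (collect (suc k) (k !) (n C k) (n C suc k)) ⟩
  + ((n C k ℕ.+ n C suc k) ℕ.* suc k !)           ≡⟨ cong (λ c → + (c ℕ.* suc k !)) (nCk+nC[k+1]≡[n+1]C[k+1] n k) ⟩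
  + ((suc n C suc k) ℕ.* suc k !)                   ∎
  where
  F = fall (+ n) k
  split : ∀ F N K → (1ℤ + N) * F ≡ F * (N - K) + (1ℤ + K) * F
  split = solve-∀
  collect : ∀ a f x y → y ℕ.* (a ℕ.* f) ℕ.+ a ℕ.* (x ℕ.* f) ≡ (x ℕ.+ y) ℕ.* (a ℕ.* f)
  collect = ℕ-Solver.solve-∀

binom-nonneg : ∀ n x → binom (+ n) x ≡ choose n x
binom-nonneg n (+ k)    = trans (cong (λ f → (f /ℕ k !) {{k !≢0}}) (fall≡nCk*k! n k))
                                (cong +_ (m*n/n≡m (n C k) (k !) {{k !≢0}}))
binom-nonneg n -[1+ _ ] = refl

1+[x-1]≡x : ∀ x → 1ℤ + (x - 1ℤ) ≡ x
1+[x-1]≡x = solve-∀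

choose-pascal : ∀ n x → choose (suc n) x ≡ choose n (x - 1ℤ) + choose n x
choose-pascal n x = subst (λ y → choose (suc n) y ≡ choose n (x - 1ℤ) + choose n y)
                          (1+[x-1]≡x x) (pascal (x - 1ℤ))
  where
  pascal : ∀ y → choose (suc n) (1ℤ + y) ≡ choose n y + choose n (1ℤ + y)
  pascal (+ k)           = cong +_ (sym (nCk+nC[k+1]≡[n+1]C[k+1] n k))
  pascal -[1+ zero ]     = refl
  pascal -[1+ suc _ ]    = refl

choose-absorb : ∀ n x → x * choose (suc n) x ≡ + suc n * choose n (x - 1ℤ)
choose-absorb n x = subst (λ y → y * choose (suc n) y ≡ + suc n * choose n (x - 1ℤ))
                          (1+[x-1]≡x x) (absorb (x - 1ℤ))
  where
  absorb : ∀ y → (1ℤ + y) * choose (suc n) (1ℤ + y) ≡ + suc n * choose n y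
  absorb (+ k)        = begin
    + suc k * + (suc n C suc k)  ≡⟨ ℤₚ.pos-* (suc k) _ ⟨
    + (suc k ℕ.* (suc n C suc k)) ≡⟨ cong +_ ([k+1]*[n+1]C[k+1]≡[n+1]*nCk n k) ⟩
    + (suc n ℕ.* (n C k))        ≡⟨ ℤₚ.pos-* (suc n) _ ⟩
    + suc n * + (n C k)          ∎
  absorb -[1+ zero ]  = sym (ℤₚ.*-zeroʳ (+ suc n))
  absorb -[1+ suc j ] = trans (ℤₚ.*-zeroʳ -[1+ j ]) (sym (ℤₚ.*-zeroʳ (+ suc n)))

choose-vanish : ∀ {n k} → n < k → choose n (+ k) ≡ 0ℤ
choose-vanish n<k = cong +_ (k>n⇒nCk≡0 n<k)

choose-sym : ∀ n x → choose n (+ n - x) ≡ choose n x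
choose-sym n (+ k) with k ℕₚ.≤? n
... | yes k≤n = trans (cong (choose n) (trans (ℤₚ.m-n≡m⊖n n k) (ℤₚ.⊖-≥ k≤n)))
                      (cong +_ (sym (nCk≡nC[n∸k] k≤n)))
... | no  k≰n = trans (cong (choose n) (trans (ℤₚ.m-n≡m⊖n n k) (ℤₚ.⊖-< (ℕₚ.≰⇒> k≰n))))
                      (trans (choose-negated (ℕₚ.m<n⇒0<n∸m (ℕₚ.≰⇒> k≰n)))
                             (sym (choose-vanish (ℕₚ.≰⇒> k≰n))))
  where
  choose-negated : ∀ {j} → 0 < j → choose n (- + j) ≡ 0ℤ
  choose-negated {suc _} _ = refl
choose-sym n -[1+ j ] = choose-vanish (ℕₚ.m<m+n n (s≤s ℕ.z≤n))

choose-odd-sym : ∀ k → choose (suc (2 ℕ.* k)) (+ suc k) ≡ choose (suc (2 ℕ.* k)) (+ k)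
choose-odd-sym k = trans (cong (choose (suc (2 ℕ.* k))) mirror) (choose-sym (suc (2 ℕ.* k)) (+ k))
  where
  reflect : ∀ K → 1ℤ + K ≡ 1ℤ + + 2 * K - K
  reflect = solve-∀
  mirror : + suc k ≡ + suc (2 ℕ.* k) - + k
  mirror = trans (reflect (+ k)) (cong (λ t → 1ℤ + t - + k) (sym (ℤₚ.pos-* 2 k)))

choose-even-sym : ∀ n → choose (2 ℕ.* n) (+ n + 1ℤ) ≡ choose (2 ℕ.* n) (+ n - 1ℤ)
choose-even-sym n = trans (cong (choose (2 ℕ.* n)) mirror) (choose-sym (2 ℕ.* n) (+ n - 1ℤ))
  where
  reflect : ∀ N → N + 1ℤ ≡ + 2 * N - (N - 1ℤ)
  reflect = solve-∀
  mirror : + n + 1ℤ ≡ + (2 ℕ.* n) - (+ n - 1ℤ)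
  mirror = trans (reflect (+ n)) (cong (_- (+ n - 1ℤ)) (sym (ℤₚ.pos-* 2 n)))

choose-pascal² : ∀ n x → choose (suc (suc n)) (1ℤ + x) ≡ choose n (x - 1ℤ) + + 2 * choose n x + choose n (x + 1ℤ)
choose-pascal² n x = begin
  choose (suc (suc n)) (1ℤ + x)
    ≡⟨ choose-pascal (suc n) (1ℤ + x) ⟩
  choose (suc n) (1ℤ + x - 1ℤ) + choose (suc n) (1ℤ + x)
    ≡⟨ cong₂ _+_ (choose-pascal n (1ℤ + x - 1ℤ)) (choose-pascal n (1ℤ + x)) ⟩
  (choose n (1ℤ + x - 1ℤ - 1ℤ) + choose n (1ℤ + x - 1ℤ)) + (choose n (1ℤ + x - 1ℤ) + choose n (1ℤ + x))
    ≡⟨ cong₂ (λ u v → (choose n u + choose n v) + (choose n v + choose n (1ℤ + x))) (lower x) (middle x) ⟩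
  (choose n (x - 1ℤ) + choose n x) + (choose n x + choose n (1ℤ + x))
    ≡⟨ cong (λ u → (choose n (x - 1ℤ) + choose n x) + (choose n x + choose n u)) (ℤₚ.+-comm 1ℤ x) ⟩
  (choose n (x - 1ℤ) + choose n x) + (choose n x + choose n (x + 1ℤ))
    ≡⟨ collect (choose n (x - 1ℤ)) (choose n x) (choose n (x + 1ℤ)) ⟩
  choose n (x - 1ℤ) + + 2 * choose n x + choose n (x + 1ℤ) ∎
  where
  lower : ∀ x → 1ℤ + x - 1ℤ - 1ℤ ≡ x - 1ℤ
  lower = solve-∀
  middle : ∀ x → 1ℤ + x - 1ℤ ≡ x
  middle = solve-∀
  collect : ∀ a b c → (a + b) + (b + c) ≡ a + + 2 * b + c
  collect = solve-∀

pos-suc : ∀ k → + suc k ≡ + k + 1ℤ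
pos-suc k = cong +_ (ℕₚ.+-comm 1 k)

-- Under the reversed-limit convention, N ↦ Σ N f is the unique function on ℤ that vanishes at 0 and
-- has increments f; all summation identities below are proved by comparing increments.
Σ : ℤ → (ℤ → ℤ) → ℤ
Σ N f = sumZ 0ℤ N f

Σ-suc : ∀ N f → Σ (N + 1ℤ) f ≡ Σ N f + f N
Σ-suc (+ k) f
  rewrite ℕₚ.+-identityʳ (k ℕ.+ 1) | ℕₚ.+-comm k 1 | ℕₚ.+-identityʳ k = refl
Σ-suc -[1+ zero ] f = cancel (f -[1+ 0 ])
  where
  cancel : ∀ x → 0ℤ ≡ - (0ℤ + x) + x
  cancel = solve-∀
Σ-suc -[1+ suc j ] f = begin
  - sumFrom -[1+ j ] (suc j) f                             ≡⟨ regroup (f -[1+ suc j ]) (sumFrom -[1+ j ] (suc j) f) ⟩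
  - (f -[1+ suc j ] + sumFrom -[1+ j ] (suc j) f) + f -[1+ suc j ]
    ≡⟨ cong (λ t → - t + f -[1+ suc j ]) (sym (sumFrom-cons -[1+ suc j ] (suc j))) ⟩
  - sumFrom -[1+ suc j ] (suc (suc j)) f + f -[1+ suc j ]   ∎
  where
  regroup : ∀ x s → - s ≡ - (x + s) + x
  regroup = solve-∀
  sumFrom-cons : ∀ M k → sumFrom M (suc k) f ≡ f M + sumFrom (1ℤ + M) k f
  sumFrom-cons M zero    = trans (cong (λ t → 0ℤ + f t) (ℤₚ.+-identityʳ M)) (ℤₚ.+-comm 0ℤ (f M))
  sumFrom-cons M (suc k) = begin
    sumFrom M (suc k) f + f (M + + suc k)                 ≡⟨ cong₂ _+_ (sumFrom-cons M k) (cong f (shift M (+ k))) ⟩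
    f M + sumFrom (1ℤ + M) k f + f (1ℤ + M + + k)         ≡⟨ ℤₚ.+-assoc (f M) _ _ ⟩
    f M + (sumFrom (1ℤ + M) k f + f (1ℤ + M + + k))       ∎
    where
    shift : ∀ M K → M + (1ℤ + K) ≡ 1ℤ + M + K
    shift = solve-∀

ℤ-induction : (P : ℤ → Set) → P 0ℤ → (∀ N → P N → P (N + 1ℤ)) → (∀ N → P (N + 1ℤ) → P N) → ∀ N → P N
ℤ-induction P p₀ up down (+ zero)      = p₀
ℤ-induction P p₀ up down (+ suc k)     =
  subst P (cong +_ (ℕₚ.+-comm k 1)) (up (+ k) (ℤ-induction P p₀ up down (+ k)))
ℤ-induction P p₀ up down -[1+ zero ]   = down -[1+ 0 ] p₀
ℤ-induction P p₀ up down -[1+ suc k ]  = down -[1+ suc k ] (ℤ-induction P p₀ up down -[1+ k ])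

≡-by-increments : (F G : ℤ → ℤ) → F 0ℤ ≡ G 0ℤ →
                  (∀ N → F (N + 1ℤ) - F N ≡ G (N + 1ℤ) - G N) → ∀ N → F N ≡ G N
≡-by-increments F G F₀≡G₀ Δ≡ = ℤ-induction (λ N → F N ≡ G N) F₀≡G₀ up down
  where
  step : ∀ a a′ → a′ ≡ (a′ - a) + a
  step = solve-∀
  unstep : ∀ a a′ → a ≡ a′ - (a′ - a)
  unstep = solve-∀
  up : ∀ N → F N ≡ G N → F (N + 1ℤ) ≡ G (N + 1ℤ)
  up N eq = begin
    F (N + 1ℤ)                   ≡⟨ step (F N) (F (N + 1ℤ)) ⟩
    (F (N + 1ℤ) - F N) + F N     ≡⟨ cong₂ _+_ (Δ≡ N) eq ⟩
    (G (N + 1ℤ) - G N) + G N     ≡⟨ step (G N) (G (N + 1ℤ)) ⟨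
    G (N + 1ℤ)                   ∎
  down : ∀ N → F (N + 1ℤ) ≡ G (N + 1ℤ) → F N ≡ G N
  down N eq = begin
    F N                          ≡⟨ unstep (F N) (F (N + 1ℤ)) ⟩
    F (N + 1ℤ) - (F (N + 1ℤ) - F N) ≡⟨ cong₂ _-_ eq (Δ≡ N) ⟩
    G (N + 1ℤ) - (G (N + 1ℤ) - G N) ≡⟨ unstep (G N) (G (N + 1ℤ)) ⟨
    G N                          ∎

Σ-increment : ∀ N f → Σ (N + 1ℤ) f - Σ N f ≡ f N
Σ-increment N f = trans (cong (_- Σ N f) (Σ-suc N f)) (cancel (Σ N f) (f N))
  where
  cancel : ∀ s x → s + x - s ≡ x
  cancel = solve-∀

Σ-cong : ∀ N {f g} → (∀ x → f x ≡ g x) → Σ N f ≡ Σ N g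
Σ-cong N {f} {g} f≗g = ≡-by-increments (λ N → Σ N f) (λ N → Σ N g) refl
  (λ N → trans (Σ-increment N f) (trans (f≗g N) (sym (Σ-increment N g)))) N

Σ-+ : ∀ N f g → Σ N (λ x → f x + g x) ≡ Σ N f + Σ N g
Σ-+ N f g = ≡-by-increments (λ N → Σ N (λ x → f x + g x)) (λ N → Σ N f + Σ N g) refl
  (λ N → trans (Σ-increment N _)
           (trans (cong₂ _+_ (sym (Σ-increment N f)) (sym (Σ-increment N g))) (regroup (Σ (N + 1ℤ) f) (Σ N f) (Σ (N + 1ℤ) g) (Σ N g)))) N
  where
  regroup : ∀ a b c d → (a - b) + (c - d) ≡ (a + c) - (b + d)
  regroup = solve-∀

Σ-- : ∀ N f g → Σ N (λ x → f x - g x) ≡ Σ N f - Σ N g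
Σ-- N f g = ≡-by-increments (λ N → Σ N (λ x → f x - g x)) (λ N → Σ N f - Σ N g) refl
  (λ N → trans (Σ-increment N _)
           (trans (cong₂ _-_ (sym (Σ-increment N f)) (sym (Σ-increment N g))) (regroup (Σ (N + 1ℤ) f) (Σ N f) (Σ (N + 1ℤ) g) (Σ N g)))) N
  where
  regroup : ∀ a b c d → (a - b) - (c - d) ≡ (a - c) - (b - d)
  regroup = solve-∀

Σ-*ˡ : ∀ N c f → Σ N (λ x → c * f x) ≡ c * Σ N f
Σ-*ˡ N c f = ≡-by-increments (λ N → Σ N (λ x → c * f x)) (λ N → c * Σ N f) (sym (ℤₚ.*-zeroʳ c))
  (λ N → trans (Σ-increment N _)
           (trans (cong (c *_) (sym (Σ-increment N f))) (distrib c _ _))) N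
  where
  distrib : ∀ c a b → c * (a - b) ≡ c * a - c * b
  distrib = solve-∀

Σ-shift : ∀ N f → Σ (N + 1ℤ) f ≡ f 0ℤ + Σ N (λ x → f (1ℤ + x))
Σ-shift N f = ≡-by-increments (λ N → Σ (N + 1ℤ) f) (λ N → f 0ℤ + Σ N (λ x → f (1ℤ + x)))
  (trans (Σ-suc 0ℤ f) (ℤₚ.+-comm 0ℤ (f 0ℤ)))
  (λ N → begin
    Σ (N + 1ℤ + 1ℤ) f - Σ (N + 1ℤ) f            ≡⟨ Σ-increment (N + 1ℤ) f ⟩
    f (N + 1ℤ)                                  ≡⟨ cong f (ℤₚ.+-comm N 1ℤ) ⟩
    f (1ℤ + N)                                  ≡⟨ Σ-increment N (λ x → f (1ℤ + x)) ⟨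
    Σ (N + 1ℤ) g - Σ N g                        ≡⟨ cancel (f 0ℤ) (Σ (N + 1ℤ) g) (Σ N g) ⟩
    (f 0ℤ + Σ (N + 1ℤ) g) - (f 0ℤ + Σ N g)      ∎) N
  where
  g : ℤ → ℤ
  g x = f (1ℤ + x)
  cancel : ∀ a b c → b - c ≡ (a + b) - (a + c)
  cancel = solve-∀

Σ-reverse : ∀ n f → Σ (+ suc n) f ≡ Σ (+ suc n) (λ l → f (+ n - l))
Σ-reverse zero    f = refl
Σ-reverse (suc n) f = begin
  Σ (+ suc (suc n)) f                                    ≡⟨ cong (λ N → Σ N f) (pos-suc (suc n)) ⟩
  Σ (+ suc n + 1ℤ) f                                     ≡⟨ Σ-suc (+ suc n) f ⟩
  Σ (+ suc n) f + f (+ suc n)                            ≡⟨ cong (_+ f (+ suc n)) (Σ-reverse n f) ⟩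
  Σ (+ suc n) (λ l → f (+ n - l)) + f (+ suc n)          ≡⟨ ℤₚ.+-comm _ (f (+ suc n)) ⟩
  f (+ suc n) + Σ (+ suc n) (λ l → f (+ n - l))
    ≡⟨ cong₂ _+_ (cong f (sym (ℤₚ.+-identityʳ (+ suc n)))) (Σ-cong (+ suc n) (λ x → cong f (shift (+ n) x))) ⟩
  f (+ suc n - 0ℤ) + Σ (+ suc n) (λ x → f (+ suc n - (1ℤ + x)))
    ≡⟨ Σ-shift (+ suc n) (λ l → f (+ suc n - l)) ⟨
  Σ (+ suc n + 1ℤ) (λ l → f (+ suc n - l))               ≡⟨ cong (λ N → Σ N (λ l → f (+ suc n - l))) (pos-suc (suc n)) ⟨
  Σ (+ suc (suc n)) (λ l → f (+ suc n - l))              ∎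
  where
  shift : ∀ N x → N - x ≡ (1ℤ + N) - (1ℤ + x)
  shift = solve-∀

Σ-telescope : ∀ (F : ℤ → ℤ) N → Σ N (λ i → F (i + 1ℤ) - F i) ≡ F N - F 0ℤ
Σ-telescope F = ≡-by-increments (λ N → Σ N (λ i → F (i + 1ℤ) - F i)) (λ N → F N - F 0ℤ) (sym (ℤₚ.+-inverseʳ (F 0ℤ)))
  (λ N → trans (Σ-increment N (λ i → F (i + 1ℤ) - F i)) (cancel (F (N + 1ℤ)) (F N) (F 0ℤ)))
  where
  cancel : ∀ a b c → a - b ≡ (a - c) - (b - c)
  cancel = solve-∀

Σ-by-parts : ∀ (a g : ℤ → ℤ) N → Σ N (λ j → (g j - g (j + 1ℤ)) * Σ (j + 1ℤ) a) + g N * Σ N a ≡ Σ N (λ i → a i * g i)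
Σ-by-parts a g = ≡-by-increments (λ N → Σ N h + g N * Σ N a) (λ N → Σ N (λ i → a i * g i)) (zero-sum (g 0ℤ))
  (λ N → begin
    (Σ (N + 1ℤ) h + g (N + 1ℤ) * Σ (N + 1ℤ) a) - (Σ N h + g N * Σ N a)
      ≡⟨ cong₂ (λ s t → (s + g (N + 1ℤ) * t) - (Σ N h + g N * Σ N a)) (Σ-suc N h) (Σ-suc N a) ⟩
    (Σ N h + (g N - g (N + 1ℤ)) * Σ (N + 1ℤ) a + g (N + 1ℤ) * (Σ N a + a N)) - (Σ N h + g N * Σ N a)
      ≡⟨ cong (λ t → (Σ N h + (g N - g (N + 1ℤ)) * t + g (N + 1ℤ) * (Σ N a + a N)) - (Σ N h + g N * Σ N a))
              (Σ-suc N a) ⟩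
    (Σ N h + (g N - g (N + 1ℤ)) * (Σ N a + a N) + g (N + 1ℤ) * (Σ N a + a N)) - (Σ N h + g N * Σ N a)
      ≡⟨ collect (Σ N h) (g N) (g (N + 1ℤ)) (Σ N a) (a N) ⟩
    a N * g N
      ≡⟨ Σ-increment N (λ i → a i * g i) ⟨
    Σ (N + 1ℤ) (λ i → a i * g i) - Σ N (λ i → a i * g i) ∎)
  where
  h : ℤ → ℤ
  h j = (g j - g (j + 1ℤ)) * Σ (j + 1ℤ) a
  zero-sum : ∀ x → 0ℤ + x * 0ℤ ≡ 0ℤ
  zero-sum = solve-∀
  collect : ∀ s gN gN′ A aN → (s + (gN - gN′) * (A + aN) + gN′ * (A + aN)) - (s + gN * A) ≡ aN * gN
  collect = solve-∀

-- Central binomial coefficients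

central : ℤ → ℤ
central l = binom (+ 2 * l) l

central-nonneg : ∀ i → central (+ i) ≡ choose (2 ℕ.* i) (+ i)
central-nonneg i = trans (cong (λ t → binom t (+ i)) (sym (ℤₚ.pos-* 2 i))) (binom-nonneg (2 ℕ.* i) (+ i))

binom-even : ∀ n x → binom (+ 2 * + n) x ≡ choose (2 ℕ.* n) x
binom-even n x = trans (cong (λ t → binom t x) (sym (ℤₚ.pos-* 2 n))) (binom-nonneg (2 ℕ.* n) x)

central-suc : ∀ l → (1ℤ + l) * central (1ℤ + l) ≡ + 2 * (+ 2 * l + 1ℤ) * central l
central-suc (+ i) = ℤₚ.*-cancelˡ-≡ (+ suc i) _ _ (begin
  + suc i * (+ suc i * central (+ suc i))
    ≡⟨ cong (λ c → + suc i * (+ suc i * c)) (trans (central-nonneg (suc i)) (cong (λ t → choose t (+ suc i)) (ℕₚ.*-suc 2 i))) ⟩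
  + suc i * (+ suc i * choose (suc (suc n)) (+ suc i))
    ≡⟨ cong (+ suc i *_) (choose-absorb (suc n) (+ suc i)) ⟩
  + suc i * (+ suc (suc n) * choose (suc n) (+ suc i - 1ℤ))
    ≡⟨ cong (λ x → + suc i * (+ suc (suc n) * choose (suc n) x)) (1+x-1≡x (+ i)) ⟩
  + suc i * (+ suc (suc n) * choose (suc n) (+ i))
    ≡⟨ cong (λ c → + suc i * (+ suc (suc n) * c)) (sym (choose-odd-sym i)) ⟩
  + suc i * (+ suc (suc n) * choose (suc n) (+ suc i))
    ≡⟨ swap (+ suc i) (+ suc (suc n)) _ ⟩
  + suc (suc n) * (+ suc i * choose (suc n) (+ suc i))
    ≡⟨ cong (+ suc (suc n) *_) (trans (choose-absorb n (+ suc i)) (cong (λ x → + suc n * choose n x) (1+x-1≡x (+ i)))) ⟩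
  + suc (suc n) * (+ suc n * choose n (+ i))
    ≡⟨ cong (λ m → (1ℤ + (1ℤ + m)) * ((1ℤ + m) * choose n (+ i))) (ℤₚ.pos-* 2 i) ⟩
  (1ℤ + (1ℤ + + 2 * + i)) * ((1ℤ + + 2 * + i) * choose n (+ i))
    ≡⟨ regroup (+ i) (choose n (+ i)) ⟩
  + suc i * (+ 2 * (+ 2 * + i + 1ℤ) * choose n (+ i))
    ≡⟨ cong (λ c → + suc i * (+ 2 * (+ 2 * + i + 1ℤ) * c)) (sym (central-nonneg i)) ⟩
  + suc i * (+ 2 * (+ 2 * + i + 1ℤ) * central (+ i)) ∎)
  where
  n = 2 ℕ.* i
  1+x-1≡x : ∀ x → 1ℤ + x - 1ℤ ≡ x
  1+x-1≡x = solve-∀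
  swap : ∀ a b c → a * (b * c) ≡ b * (a * c)
  swap = solve-∀
  regroup : ∀ I c → (1ℤ + (1ℤ + + 2 * I)) * ((1ℤ + + 2 * I) * c) ≡ (1ℤ + I) * (+ 2 * (+ 2 * I + 1ℤ) * c)
  regroup = solve-∀
central-suc -[1+ zero ]  = refl
central-suc -[1+ suc j ] = trans (ℤₚ.*-zeroʳ -[1+ j ]) (sym (ℤₚ.*-zeroʳ (+ 2 * (+ 2 * -[1+ suc j ] + 1ℤ))))

centralConv : ℕ → ℤ
centralConv n = Σ (+ suc n) (λ l → central (+ n - l) * central l)

weightedCentralConv : ℕ → ℤ
weightedCentralConv n = Σ (+ suc n) (λ l → l * central l * central (+ n - l))

2*weightedCentralConv≡n*centralConv : ∀ n → + 2 * weightedCentralConv n ≡ + n * centralConv n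
2*weightedCentralConv≡n*centralConv n = begin
  + 2 * W                                              ≡⟨ double W ⟩
  W + W                                                ≡⟨ cong (λ v → W + v) (trans (Σ-reverse n _)
                                                            (Σ-cong (+ suc n) (λ l → cong (λ t → (+ n - l) * central (+ n - l) * central t)
                                                                                          (reflect (+ n) l)))) ⟩
  W + Σ (+ suc n) (λ l → (+ n - l) * central (+ n - l) * central l)
                                                       ≡⟨ Σ-+ (+ suc n) _ _ ⟨
  Σ (+ suc n) (λ l → l * central l * central (+ n - l) + (+ n - l) * central (+ n - l) * central l)
                                                       ≡⟨ Σ-cong (+ suc n) (λ l → pair (+ n) l (central l) (central (+ n - l))) ⟩
  Σ (+ suc n) (λ l → + n * (central (+ n - l) * central l))
                                                       ≡⟨ Σ-*ˡ (+ suc n) (+ n) _ ⟩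
  + n * centralConv n                                  ∎
  where
  W = weightedCentralConv n
  double : ∀ w → + 2 * w ≡ w + w
  double = solve-∀
  reflect : ∀ N l → N - (N - l) ≡ l
  reflect = solve-∀
  pair : ∀ N l a b → l * a * b + (N - l) * b * a ≡ N * (b * a)
  pair = solve-∀

weightedCentralConv-suc : ∀ n → weightedCentralConv (suc n) ≡ + 4 * weightedCentralConv n + + 2 * centralConv n
weightedCentralConv-suc n = begin
  Σ (+ suc (suc n)) g                                  ≡⟨ cong (λ N → Σ N g) (pos-suc (suc n)) ⟩
  Σ (+ suc n + 1ℤ) g                                   ≡⟨ Σ-shift (+ suc n) g ⟩
  0ℤ + Σ (+ suc n) (λ x → g (1ℤ + x))                 ≡⟨ ℤₚ.+-identityˡ _ ⟩
  Σ (+ suc n) (λ x → g (1ℤ + x))                       ≡⟨ Σ-cong (+ suc n) g[1+x] ⟩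
  Σ (+ suc n) (λ x → + 4 * (x * central x * central (+ n - x)) + + 2 * (central (+ n - x) * central x))
                                                       ≡⟨ Σ-+ (+ suc n) _ _ ⟩
  Σ (+ suc n) (λ x → + 4 * (x * central x * central (+ n - x))) + Σ (+ suc n) (λ x → + 2 * (central (+ n - x) * central x))
                                                       ≡⟨ cong₂ _+_ (Σ-*ˡ (+ suc n) (+ 4) _) (Σ-*ˡ (+ suc n) (+ 2) _) ⟩
  + 4 * weightedCentralConv n + + 2 * centralConv n    ∎
  where
  g : ℤ → ℤ
  g l = l * central l * central (+ suc n - l)
  shift : ∀ N x → (1ℤ + N) - (1ℤ + x) ≡ N - x
  shift = solve-∀
  expand : ∀ x a b → + 2 * (+ 2 * x + 1ℤ) * a * b ≡ + 4 * (x * a * b) + + 2 * (b * a)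
  expand = solve-∀
  g[1+x] : ∀ x → g (1ℤ + x) ≡ + 4 * (x * central x * central (+ n - x)) + + 2 * (central (+ n - x) * central x)
  g[1+x] x = begin
    (1ℤ + x) * central (1ℤ + x) * central (+ suc n - (1ℤ + x))
      ≡⟨ cong₂ _*_ (central-suc x) (cong central (shift (+ n) x)) ⟩
    + 2 * (+ 2 * x + 1ℤ) * central x * central (+ n - x)
      ≡⟨ expand x (central x) (central (+ n - x)) ⟩
    + 4 * (x * central x * central (+ n - x)) + + 2 * (central (+ n - x) * central x) ∎

centralConv-suc : ∀ n → centralConv (suc n) ≡ + 4 * centralConv n
centralConv-suc n = ℤₚ.*-cancelˡ-≡ (+ suc n) _ _ (begin
  + suc n * centralConv (suc n)                ≡⟨ 2*weightedCentralConv≡n*centralConv (suc n) ⟨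
  + 2 * weightedCentralConv (suc n)            ≡⟨ cong (+ 2 *_) (weightedCentralConv-suc n) ⟩
  + 2 * (+ 4 * W + + 2 * T)                    ≡⟨ regroup W T ⟩
  + 4 * (+ 2 * W) + + 4 * T                    ≡⟨ cong (λ t → + 4 * t + + 4 * T) (2*weightedCentralConv≡n*centralConv n) ⟩
  + 4 * (+ n * T) + + 4 * T                    ≡⟨ collect (+ n) T ⟩
  + suc n * (+ 4 * T)                          ∎)
  where
  W = weightedCentralConv n
  T = centralConv n
  regroup : ∀ w t → + 2 * (+ 4 * w + + 2 * t) ≡ + 4 * (+ 2 * w) + + 4 * t
  regroup = solve-∀
  collect : ∀ N t → + 4 * (N * t) + + 4 * t ≡ (1ℤ + N) * (+ 4 * t)
  collect = solve-∀

-- The cross sum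

evenRow : ℕ → ℤ → ℤ
evenRow n i = choose (2 ℕ.* n) (+ n + i)

oddRow : ℕ → ℤ → ℤ
oddRow k i = choose (suc (2 ℕ.* k)) (+ k + i)

row-pascal² : ∀ n k i → choose (suc (suc n)) (+ suc k + i) ≡
                        choose n (+ k + (i - 1ℤ)) + + 2 * choose n (+ k + i) + choose n (+ k + (i + 1ℤ))
row-pascal² n k i = begin
  choose (suc (suc n)) (+ suc k + i)                 ≡⟨ cong (choose (suc (suc n))) (ℤₚ.+-assoc 1ℤ (+ k) i) ⟩
  choose (suc (suc n)) (1ℤ + (+ k + i))              ≡⟨ choose-pascal² n (+ k + i) ⟩
  choose n (+ k + i - 1ℤ) + + 2 * choose n (+ k + i) + choose n (+ k + i + 1ℤ)
    ≡⟨ cong₂ (λ u v → choose n u + + 2 * choose n (+ k + i) + choose n v) (ℤₚ.+-assoc (+ k) i -1ℤ) (ℤₚ.+-assoc (+ k) i 1ℤ) ⟩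
  choose n (+ k + (i - 1ℤ)) + + 2 * choose n (+ k + i) + choose n (+ k + (i + 1ℤ)) ∎

evenRow-suc : ∀ n i → evenRow (suc n) i ≡ evenRow n (i - 1ℤ) + + 2 * evenRow n i + evenRow n (i + 1ℤ)
evenRow-suc n i = trans (cong (λ t → choose t (+ suc n + i)) (ℕₚ.*-suc 2 n)) (row-pascal² (2 ℕ.* n) n i)

oddRow-suc : ∀ k i → oddRow (suc k) i ≡ oddRow k (i - 1ℤ) + + 2 * oddRow k i + oddRow k (i + 1ℤ)
oddRow-suc k i = trans (cong (λ t → choose (suc t) (+ suc k + i)) (ℕₚ.*-suc 2 k)) (row-pascal² (suc (2 ℕ.* k)) k i)

oddRow-vanish : ∀ k {j} → suc k < j → oddRow k (+ j) ≡ 0ℤ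
oddRow-vanish k {j} k+1<j = choose-vanish (subst (ℕ._< k ℕ.+ j) k+[k+1]≡2k+1 (ℕₚ.+-monoʳ-< k k+1<j))
  where
  k+[k+1]≡2k+1 : k ℕ.+ suc k ≡ suc (2 ℕ.* k)
  k+[k+1]≡2k+1 = trans (ℕₚ.+-suc k k) (cong (λ t → suc (k ℕ.+ t)) (sym (ℕₚ.+-identityʳ k)))

evenRow-absorb : ∀ k j → j * evenRow (suc k) j ≡ + suc k * (oddRow k j - oddRow k (j + 1ℤ))
evenRow-absorb k j = begin
  j * E                                                   ≡⟨ split (+ k) j E ⟩
  r * E - + suc k * E                                     ≡⟨ cong₂ (λ a b → a - + suc k * b) absorb pascal ⟩
  + suc N * oddRow k j - + suc k * (oddRow k j + oddRow k (j + 1ℤ))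
    ≡⟨ cong (λ t → (1ℤ + (1ℤ + t)) * oddRow k j - + suc k * (oddRow k j + oddRow k (j + 1ℤ))) (ℤₚ.pos-* 2 k) ⟩
  (1ℤ + (1ℤ + + 2 * + k)) * oddRow k j - (1ℤ + + k) * (oddRow k j + oddRow k (j + 1ℤ))
    ≡⟨ collect (+ k) (oddRow k j) (oddRow k (j + 1ℤ)) ⟩
  + suc k * (oddRow k j - oddRow k (j + 1ℤ))              ∎
  where
  N = suc (2 ℕ.* k)
  r = + suc k + j
  E = evenRow (suc k) j
  split : ∀ K j E → j * E ≡ (1ℤ + K + j) * E - (1ℤ + K) * E
  split = solve-∀
  collect : ∀ K u v → (1ℤ + (1ℤ + + 2 * K)) * u - (1ℤ + K) * (u + v) ≡ (1ℤ + K) * (u - v)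
  collect = solve-∀
  r-1 : ∀ K j → 1ℤ + K + j - 1ℤ ≡ K + j
  r-1 = solve-∀
  r=k+[j+1] : ∀ K j → 1ℤ + K + j ≡ K + (j + 1ℤ)
  r=k+[j+1] = solve-∀
  top : E ≡ choose (suc N) r
  top = cong (λ t → choose t r) (ℕₚ.*-suc 2 k)
  absorb : r * E ≡ + suc N * oddRow k j
  absorb = trans (cong (r *_) top) (trans (choose-absorb N r) (cong (λ x → + suc N * choose N x) (r-1 (+ k) j)))
  pascal : E ≡ oddRow k j + oddRow k (j + 1ℤ)
  pascal = trans top (trans (choose-pascal N r) (cong₂ (λ x y → choose N x + choose N y) (r-1 (+ k) j) (r=k+[j+1] (+ k) j)))

cross : ℕ → ℕ → ℤ
cross n k = Σ (+ suc k + 1ℤ) (λ i → evenRow n i * oddRow k i)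

doubleSum≡[1+k]*cross : ∀ n k →
  Σ (+ suc k + 1ℤ) (λ j → Σ (j + 1ℤ) (λ i → j * binom (+ 2 * + n) (+ n + i) * binom (+ 2 * + suc k) (+ suc k + j)))
  ≡ + suc k * cross n k
doubleSum≡[1+k]*cross n k = begin
  Σ N (λ j → Σ (j + 1ℤ) (λ i → j * binom (+ 2 * + n) (+ n + i) * binom (+ 2 * + suc k) (+ suc k + j)))
    ≡⟨ Σ-cong N inner ⟩
  Σ N (λ j → + suc k * h j)                              ≡⟨ Σ-*ˡ N (+ suc k) h ⟩
  + suc k * Σ N h                                        ≡⟨ cong (+ suc k *_) (sym (ℤₚ.+-identityʳ (Σ N h))) ⟩
  + suc k * (Σ N h + 0ℤ)                                 ≡⟨ cong (λ u → + suc k * (Σ N h + u * Σ N (evenRow n))) boundary ⟨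
  + suc k * (Σ N h + oddRow k N * Σ N (evenRow n))       ≡⟨ cong (+ suc k *_) (Σ-by-parts (evenRow n) (oddRow k) N) ⟩
  + suc k * cross n k                                    ∎
  where
  N = + suc k + 1ℤ
  h : ℤ → ℤ
  h j = (oddRow k j - oddRow k (j + 1ℤ)) * Σ (j + 1ℤ) (evenRow n)
  boundary : oddRow k N ≡ 0ℤ
  boundary = trans (cong (oddRow k) (sym (pos-suc (suc k)))) (oddRow-vanish k (ℕₚ.n<1+n (suc k)))
  reorder : ∀ j e a → j * a * e ≡ (j * e) * a
  reorder = solve-∀
  inner : ∀ j → Σ (j + 1ℤ) (λ i → j * binom (+ 2 * + n) (+ n + i) * binom (+ 2 * + suc k) (+ suc k + j))
              ≡ + suc k * h j
  inner j = begin
    Σ (j + 1ℤ) (λ i → j * binom (+ 2 * + n) (+ n + i) * binom (+ 2 * + suc k) (+ suc k + j))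
      ≡⟨ Σ-cong (j + 1ℤ) (λ i → trans (cong₂ (λ a e → j * a * e) (binom-even n (+ n + i)) (binom-even (suc k) (+ suc k + j)))
                                        (reorder j (evenRow (suc k) j) (evenRow n i))) ⟩
    Σ (j + 1ℤ) (λ i → (j * evenRow (suc k) j) * evenRow n i)
      ≡⟨ Σ-*ˡ (j + 1ℤ) (j * evenRow (suc k) j) (evenRow n) ⟩
    (j * evenRow (suc k) j) * Σ (j + 1ℤ) (evenRow n)
      ≡⟨ cong (_* Σ (j + 1ℤ) (evenRow n)) (evenRow-absorb k j) ⟩
    + suc k * (oddRow k j - oddRow k (j + 1ℤ)) * Σ (j + 1ℤ) (evenRow n)
      ≡⟨ ℤₚ.*-assoc (+ suc k) (oddRow k j - oddRow k (j + 1ℤ)) (Σ (j + 1ℤ) (evenRow n)) ⟩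
    + suc k * h j ∎

crossBoundary : ℕ → ℕ → ℤ
crossBoundary n k = evenRow n -1ℤ * oddRow k 0ℤ - evenRow n 0ℤ * oddRow k -1ℤ

cross-diagonal : ∀ n k → cross (suc n) k - cross n (suc k) ≡ crossBoundary n k
cross-diagonal n k = begin
  cross (suc n) k - cross n (suc k)   ≡⟨ cong (_- cross n (suc k)) extend ⟩
  Σ K f₁ - Σ K f₂                     ≡⟨ Σ-- K f₁ f₂ ⟨
  Σ K (λ i → f₁ i - f₂ i)             ≡⟨ Σ-cong K increment ⟩
  Σ K (λ i → F (i + 1ℤ) - F i)        ≡⟨ Σ-telescope F K ⟩
  F K - F 0ℤ                          ≡⟨ cong₂ (λ u v → p K * u - p (K - 1ℤ) * v - F 0ℤ) top-vanishes q[k+3]≡0 ⟩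
  p K * 0ℤ - p (K - 1ℤ) * 0ℤ - F 0ℤ   ≡⟨ boundary (p K) (p (K - 1ℤ)) (p 0ℤ) (q -1ℤ) (p -1ℤ) (q 0ℤ) ⟩
  crossBoundary n k                   ∎
  where
  p = evenRow n
  q = oddRow k
  K₁ = + suc k + 1ℤ
  K  = + suc (suc k) + 1ℤ
  f₁ f₂ F : ℤ → ℤ
  f₁ i = evenRow (suc n) i * q i
  f₂ i = p i * oddRow (suc k) i
  F i = p i * q (i - 1ℤ) - p (i - 1ℤ) * q i
  i+1-1≡i : ∀ i → i + 1ℤ - 1ℤ ≡ i
  i+1-1≡i = solve-∀
  q[k+2]≡0 : q (+ suc (suc k)) ≡ 0ℤ
  q[k+2]≡0 = oddRow-vanish k (ℕₚ.n<1+n (suc k))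
  q[k+3]≡0 : q K ≡ 0ℤ
  q[k+3]≡0 = oddRow-vanish k (ℕₚ.<-trans (ℕₚ.n<1+n (suc k)) (ℕₚ.m<m+n (suc (suc k)) (s≤s ℕ.z≤n)))
  top-vanishes : q (K - 1ℤ) ≡ 0ℤ
  top-vanishes = trans (cong q (i+1-1≡i (+ suc (suc k)))) q[k+2]≡0
  extend : cross (suc n) k ≡ Σ K f₁
  extend = begin
    Σ K₁ f₁                       ≡⟨ ℤₚ.+-identityʳ (Σ K₁ f₁) ⟨
    Σ K₁ f₁ + 0ℤ                  ≡⟨ cong (λ u → Σ K₁ f₁ + u) (ℤₚ.*-zeroʳ (evenRow (suc n) K₁)) ⟨
    Σ K₁ f₁ + evenRow (suc n) K₁ * 0ℤ ≡⟨ cong (λ u → Σ K₁ f₁ + evenRow (suc n) K₁ * u)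
                                         (trans (cong q (sym (pos-suc (suc k)))) q[k+2]≡0) ⟨
    Σ K₁ f₁ + f₁ K₁               ≡⟨ Σ-suc K₁ f₁ ⟨
    Σ (K₁ + 1ℤ) f₁                ≡⟨ cong (λ N → Σ (N + 1ℤ) f₁) (pos-suc (suc k)) ⟨
    Σ K f₁                        ∎
  expand : ∀ a b c u v w → (a + + 2 * b + c) * v - b * (u + + 2 * v + w) ≡ (c * v - b * w) - (b * u - a * v)
  expand = solve-∀
  increment : ∀ i → f₁ i - f₂ i ≡ F (i + 1ℤ) - F i
  increment i = begin
    f₁ i - f₂ i
      ≡⟨ cong₂ (λ a b → a * q i - p i * b) (evenRow-suc n i) (oddRow-suc k i) ⟩
    (p (i - 1ℤ) + + 2 * p i + p (i + 1ℤ)) * q i - p i * (q (i - 1ℤ) + + 2 * q i + q (i + 1ℤ))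
      ≡⟨ expand (p (i - 1ℤ)) (p i) (p (i + 1ℤ)) (q (i - 1ℤ)) (q i) (q (i + 1ℤ)) ⟩
    (p (i + 1ℤ) * q i - p i * q (i + 1ℤ)) - F i
      ≡⟨ cong (λ j → (p (i + 1ℤ) * q j - p j * q (i + 1ℤ)) - F i) (i+1-1≡i i) ⟨
    F (i + 1ℤ) - F i
      ∎
  boundary : ∀ a b c d e f → a * 0ℤ - b * 0ℤ - (c * d - e * f) ≡ e * f - c * d
  boundary = solve-∀

-- The right-hand side

conv : ℤ → ℤ → ℤ
conv n p = Σ (n - p + 1ℤ) (λ l → central (n - l) * central (p + l))

conv-diagonal : ∀ n p → conv (n + 1ℤ) p ≡ conv n (p + 1ℤ) + + 2 * central (n + 1ℤ) * central p
conv-diagonal n p = begin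
  Σ (n + 1ℤ - p + 1ℤ) f                   ≡⟨ cong (λ L → Σ L f) (limit₁ n p) ⟩
  Σ (N + 1ℤ + 1ℤ) f                       ≡⟨ Σ-shift (N + 1ℤ) f ⟩
  f 0ℤ + Σ (N + 1ℤ) (λ x → f (1ℤ + x))    ≡⟨ cong (λ s → f 0ℤ + s) (Σ-cong (N + 1ℤ) f[1+x]) ⟩
  f 0ℤ + Σ (N + 1ℤ) g                     ≡⟨ cong (λ s → f 0ℤ + s) (Σ-suc N g) ⟩
  f 0ℤ + (Σ N g + g N)                    ≡⟨ cong₂ (λ a b → a + (Σ N g + b)) f0 gN ⟩
  central (n + 1ℤ) * central p + (Σ N g + central p * central (n + 1ℤ))
                                          ≡⟨ collect (Σ N g) (central (n + 1ℤ)) (central p) ⟩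
  Σ N g + + 2 * central (n + 1ℤ) * central p
                                          ≡⟨ cong (λ L → Σ L g + + 2 * central (n + 1ℤ) * central p) (limit₂ n p) ⟨
  conv n (p + 1ℤ) + + 2 * central (n + 1ℤ) * central p ∎
  where
  N = n - p
  f g : ℤ → ℤ
  f l = central (n + 1ℤ - l) * central (p + l)
  g l = central (n - l) * central (p + 1ℤ + l)
  limit₁ : ∀ n p → n + 1ℤ - p + 1ℤ ≡ n - p + 1ℤ + 1ℤ
  limit₁ = solve-∀
  limit₂ : ∀ n p → n - (p + 1ℤ) + 1ℤ ≡ n - p
  limit₂ = solve-∀
  shiftˡ : ∀ n x → n + 1ℤ - (1ℤ + x) ≡ n - x
  shiftˡ = solve-∀
  shiftʳ : ∀ p x → p + (1ℤ + x) ≡ p + 1ℤ + x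
  shiftʳ = solve-∀
  f[1+x] : ∀ x → f (1ℤ + x) ≡ g x
  f[1+x] x = cong₂ (λ a b → central a * central b) (shiftˡ n x) (shiftʳ p x)
  at0ˡ : ∀ n → n + 1ℤ - 0ℤ ≡ n + 1ℤ
  at0ˡ = solve-∀
  f0 : f 0ℤ ≡ central (n + 1ℤ) * central p
  f0 = cong₂ (λ a b → central a * central b) (at0ˡ n) (ℤₚ.+-identityʳ p)
  atNˡ : ∀ n p → n - (n - p) ≡ p
  atNˡ = solve-∀
  atNʳ : ∀ n p → p + 1ℤ + (n - p) ≡ n + 1ℤ
  atNʳ = solve-∀
  gN : g N ≡ central p * central (n + 1ℤ)
  gN = cong₂ (λ a b → central a * central b) (atNˡ n p) (atNʳ n p)
  collect : ∀ s a b → a * b + (s + b * a) ≡ s + + 2 * a * b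
  collect = solve-∀

conv-zero : ∀ n → conv (+ n) 0ℤ ≡ centralConv n
conv-zero n = trans (cong (λ L → Σ L (λ l → central (+ n - l) * central (0ℤ + l))) (limit (+ n)))
                    (Σ-cong (+ suc n) (λ l → cong (λ t → central (+ n - l) * central t) (ℤₚ.+-identityˡ l)))
  where
  limit : ∀ N → N - 0ℤ + 1ℤ ≡ 1ℤ + N
  limit = solve-∀

conv-one : ∀ n → conv (+ n) 1ℤ ≡ + 4 * centralConv n - + 2 * central (+ n + 1ℤ)
conv-one n = begin
  conv (+ n) 1ℤ                                             ≡⟨ cancel (conv (+ n) 1ℤ) (+ 2 * central (+ n + 1ℤ)) ⟩
  conv (+ n) 1ℤ + + 2 * central (+ n + 1ℤ) * 1ℤ - + 2 * central (+ n + 1ℤ)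
                                                            ≡⟨ cong (_- + 2 * central (+ n + 1ℤ)) (conv-diagonal (+ n) 0ℤ) ⟨
  conv (+ n + 1ℤ) 0ℤ - + 2 * central (+ n + 1ℤ)             ≡⟨ cong (λ N → conv N 0ℤ - + 2 * central (+ n + 1ℤ)) (pos-suc n) ⟨
  conv (+ suc n) 0ℤ - + 2 * central (+ n + 1ℤ)
    ≡⟨ cong (_- + 2 * central (+ n + 1ℤ)) (trans (conv-zero (suc n)) (centralConv-suc n)) ⟩
  + 4 * centralConv n - + 2 * central (+ n + 1ℤ)            ∎
  where
  cancel : ∀ x y → x ≡ x + y * 1ℤ - y
  cancel = solve-∀

nearCentral : ℤ → ℤ
nearCentral l = binom (+ 2 * l) (l - 1ℤ)

-- The right-hand side of the theorem is m · rhs n m (m*rhs-expand): binom (2m−2) (m−2) is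
-- nearCentral (m − 1), and its two sums are conv n m and conv n (m − 1).
rhs : ℤ → ℤ → ℤ
rhs n m = + 2 * central (n + m) + + 8 * central n * nearCentral (m - 1ℤ) - conv n m + + 4 * conv n (m - 1ℤ)

diagonalCorrection : ℤ → ℤ → ℤ
diagonalCorrection n m = + 8 * central (n + 1ℤ) * (nearCentral (m - 1ℤ) + central (m - 1ℤ))
                       - + 8 * central n * nearCentral m - + 2 * central (n + 1ℤ) * central m

rhs-diagonal : ∀ n m → rhs (n + 1ℤ) m ≡ rhs n (m + 1ℤ) + diagonalCorrection n m
rhs-diagonal n m = begin
  + 2 * central (n + 1ℤ + m) + + 8 * c′ * nearCentral (m - 1ℤ) - conv (n + 1ℤ) m + + 4 * conv (n + 1ℤ) (m - 1ℤ)
    ≡⟨ cong₂ (λ a b → + 2 * central (n + 1ℤ + m) + + 8 * c′ * nearCentral (m - 1ℤ) - a + + 4 * b)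
             (conv-diagonal n m) (trans (conv-diagonal n (m - 1ℤ)) (cong (λ t → conv n t + + 2 * c′ * central (m - 1ℤ)) (m-1+1≡m m))) ⟩
  + 2 * central (n + 1ℤ + m) + + 8 * c′ * nearCentral (m - 1ℤ) - (A + + 2 * c′ * central m) + + 4 * (B + + 2 * c′ * central (m - 1ℤ))
    ≡⟨ regroup (central (n + 1ℤ + m)) c c′ (nearCentral (m - 1ℤ)) (nearCentral m) A B (central m) (central (m - 1ℤ)) ⟩
  (+ 2 * central (n + 1ℤ + m) + + 8 * c * nearCentral m - A + + 4 * B) + diagonalCorrection n m
    ≡⟨ cong₂ (λ a b → (+ 2 * central a + + 8 * c * nearCentral b - A + + 4 * conv n b) + diagonalCorrection n m)
             (shift n m) (sym (m+1-1≡m m)) ⟩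
  rhs n (m + 1ℤ) + diagonalCorrection n m ∎
  where
  c = central n
  c′ = central (n + 1ℤ)
  A = conv n (m + 1ℤ)
  B = conv n m
  m-1+1≡m : ∀ m → m - 1ℤ + 1ℤ ≡ m
  m-1+1≡m = solve-∀
  m+1-1≡m : ∀ m → m + 1ℤ - 1ℤ ≡ m
  m+1-1≡m = solve-∀
  shift : ∀ n m → n + 1ℤ + m ≡ n + (m + 1ℤ)
  shift = solve-∀
  regroup : ∀ X c c′ ν ν′ A B μ μ′ →
    + 2 * X + + 8 * c′ * ν - (A + + 2 * c′ * μ) + + 4 * (B + + 2 * c′ * μ′)
    ≡ (+ 2 * X + + 8 * c * ν′ - A + + 4 * B) + (+ 8 * c′ * (ν + μ′) - + 8 * c * ν′ - + 2 * c′ * μ)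
  regroup = solve-∀

central≡evenRow : ∀ n → central (+ n) ≡ evenRow n 0ℤ
central≡evenRow n = trans (central-nonneg n) (cong (choose (2 ℕ.* n)) (sym (ℤₚ.+-identityʳ (+ n))))

central-suc-split : ∀ n → central (+ n + 1ℤ) ≡ + 2 * evenRow n 0ℤ + + 2 * evenRow n -1ℤ
central-suc-split n = begin
  central (+ n + 1ℤ)                                          ≡⟨ cong central (pos-suc n) ⟨
  central (+ suc n)                                           ≡⟨ central≡evenRow (suc n) ⟩
  evenRow (suc n) 0ℤ                                          ≡⟨ evenRow-suc n 0ℤ ⟩
  evenRow n -1ℤ + + 2 * evenRow n 0ℤ + evenRow n 1ℤ           ≡⟨ cong (λ t → evenRow n -1ℤ + + 2 * evenRow n 0ℤ + t) (choose-even-sym n) ⟩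
  evenRow n -1ℤ + + 2 * evenRow n 0ℤ + evenRow n -1ℤ          ≡⟨ collect (evenRow n -1ℤ) (evenRow n 0ℤ) ⟩
  + 2 * evenRow n 0ℤ + + 2 * evenRow n -1ℤ                    ∎
  where
  collect : ∀ p c → p + + 2 * c + p ≡ + 2 * c + + 2 * p
  collect = solve-∀

nearCentral+central : ∀ k → nearCentral (+ k) + central (+ k) ≡ oddRow k 0ℤ
nearCentral+central k = begin
  nearCentral (+ k) + central (+ k)                          ≡⟨ cong₂ _+_ (binom-even k (+ k - 1ℤ)) (central-nonneg k) ⟩
  choose (2 ℕ.* k) (+ k - 1ℤ) + choose (2 ℕ.* k) (+ k)
    ≡⟨ cong (λ x → choose (2 ℕ.* k) (x - 1ℤ) + choose (2 ℕ.* k) x) (ℤₚ.+-identityʳ (+ k)) ⟨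
  choose (2 ℕ.* k) (+ k + 0ℤ - 1ℤ) + choose (2 ℕ.* k) (+ k + 0ℤ)
                                                             ≡⟨ choose-pascal (2 ℕ.* k) (+ k + 0ℤ) ⟨
  oddRow k 0ℤ                                                ∎

nearCentral-suc : ∀ k → nearCentral (+ suc k) ≡ oddRow k -1ℤ + oddRow k 0ℤ
nearCentral-suc k = begin
  nearCentral (+ suc k)                                      ≡⟨ binom-even (suc k) (+ suc k - 1ℤ) ⟩
  choose (2 ℕ.* suc k) (+ suc k - 1ℤ)                        ≡⟨ cong (λ t → choose t (+ suc k - 1ℤ)) (ℕₚ.*-suc 2 k) ⟩
  choose (suc N) (+ suc k - 1ℤ)                              ≡⟨ choose-pascal N (+ suc k - 1ℤ) ⟩
  choose N (+ suc k - 1ℤ - 1ℤ) + choose N (+ suc k - 1ℤ)     ≡⟨ cong₂ (λ x y → choose N x + choose N y) (lower (+ k)) (upper (+ k)) ⟩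
  oddRow k -1ℤ + oddRow k 0ℤ                                 ∎
  where
  N = suc (2 ℕ.* k)
  lower : ∀ K → 1ℤ + K - 1ℤ - 1ℤ ≡ K + -1ℤ
  lower = solve-∀
  upper : ∀ K → 1ℤ + K - 1ℤ ≡ K + 0ℤ
  upper = solve-∀

central-suc-odd : ∀ k → central (+ suc k) ≡ + 2 * oddRow k 0ℤ
central-suc-odd k = begin
  central (+ suc k)                                          ≡⟨ central-nonneg (suc k) ⟩
  choose (2 ℕ.* suc k) (+ suc k)                             ≡⟨ cong (λ t → choose t (+ suc k)) (ℕₚ.*-suc 2 k) ⟩
  choose (suc N) (+ suc k)                                   ≡⟨ choose-pascal N (+ suc k) ⟩
  choose N (+ suc k - 1ℤ) + choose N (+ suc k)               ≡⟨ cong₂ (λ x y → choose N x + y) (down (+ k)) (choose-odd-sym k) ⟩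
  choose N (+ k + 0ℤ) + choose N (+ k)                       ≡⟨ cong (λ x → choose N (+ k + 0ℤ) + choose N x) (ℤₚ.+-identityʳ (+ k)) ⟨
  oddRow k 0ℤ + oddRow k 0ℤ                                  ≡⟨ double (oddRow k 0ℤ) ⟩
  + 2 * oddRow k 0ℤ                                          ∎
  where
  N = suc (2 ℕ.* k)
  down : ∀ K → 1ℤ + K - 1ℤ ≡ K + 0ℤ
  down = solve-∀
  double : ∀ x → x + x ≡ + 2 * x
  double = solve-∀

diagonalCorrection≡8*crossBoundary : ∀ n k → diagonalCorrection (+ n) (+ suc k) ≡ + 8 * crossBoundary n k
diagonalCorrection≡8*crossBoundary n k = begin
  + 8 * central (+ n + 1ℤ) * (nearCentral (+ suc k - 1ℤ) + central (+ suc k - 1ℤ))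
    - + 8 * central (+ n) * nearCentral (+ suc k) - + 2 * central (+ n + 1ℤ) * central (+ suc k)
    ≡⟨ cong (λ x → + 8 * central (+ n + 1ℤ) * (nearCentral x + central x)
                   - + 8 * central (+ n) * nearCentral (+ suc k) - + 2 * central (+ n + 1ℤ) * central (+ suc k))
            (1+K-1≡K (+ k)) ⟩
  + 8 * central (+ n + 1ℤ) * (nearCentral (+ k) + central (+ k))
    - + 8 * central (+ n) * nearCentral (+ suc k) - + 2 * central (+ n + 1ℤ) * central (+ suc k)
    ≡⟨ cong₂ (λ a b → + 8 * a * b - + 8 * central (+ n) * nearCentral (+ suc k) - + 2 * a * central (+ suc k))
             (central-suc-split n) (nearCentral+central k) ⟩
  + 8 * (+ 2 * c + + 2 * p) * u₀ - + 8 * central (+ n) * nearCentral (+ suc k) - + 2 * (+ 2 * c + + 2 * p) * central (+ suc k)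
    ≡⟨ cong₂ (λ a b → + 8 * (+ 2 * c + + 2 * p) * u₀ - + 8 * a * b - + 2 * (+ 2 * c + + 2 * p) * central (+ suc k))
             (central≡evenRow n) (nearCentral-suc k) ⟩
  + 8 * (+ 2 * c + + 2 * p) * u₀ - + 8 * c * (u₋₁ + u₀) - + 2 * (+ 2 * c + + 2 * p) * central (+ suc k)
    ≡⟨ cong (λ x → + 8 * (+ 2 * c + + 2 * p) * u₀ - + 8 * c * (u₋₁ + u₀) - + 2 * (+ 2 * c + + 2 * p) * x)
            (central-suc-odd k) ⟩
  + 8 * (+ 2 * c + + 2 * p) * u₀ - + 8 * c * (u₋₁ + u₀) - + 2 * (+ 2 * c + + 2 * p) * (+ 2 * u₀)
    ≡⟨ simplify c p u₀ u₋₁ ⟩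
  + 8 * crossBoundary n k ∎
  where
  c = evenRow n 0ℤ
  p = evenRow n -1ℤ
  u₀ = oddRow k 0ℤ
  u₋₁ = oddRow k -1ℤ
  1+K-1≡K : ∀ K → 1ℤ + K - 1ℤ ≡ K
  1+K-1≡K = solve-∀
  simplify : ∀ c p u₀ u₋₁ → + 8 * (+ 2 * c + + 2 * p) * u₀ - + 8 * c * (u₋₁ + u₀) - + 2 * (+ 2 * c + + 2 * p) * (+ 2 * u₀)
                            ≡ + 8 * (p * u₀ - c * u₋₁)
  simplify = solve-∀

cross-zero : ∀ n → cross n 0 ≡ evenRow n 0ℤ + evenRow n -1ℤ
cross-zero n = begin
  (0ℤ + evenRow n 0ℤ * 1ℤ) + evenRow n 1ℤ * 1ℤ   ≡⟨ cong (λ t → (0ℤ + evenRow n 0ℤ * 1ℤ) + t * 1ℤ) (choose-even-sym n) ⟩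
  (0ℤ + evenRow n 0ℤ * 1ℤ) + evenRow n -1ℤ * 1ℤ  ≡⟨ simplify (evenRow n 0ℤ) (evenRow n -1ℤ) ⟩
  evenRow n 0ℤ + evenRow n -1ℤ                   ∎
  where
  simplify : ∀ c p → (0ℤ + c * 1ℤ) + p * 1ℤ ≡ c + p
  simplify = solve-∀

8*cross-zero : ∀ n → + 8 * cross n 0 ≡ rhs (+ n) 1ℤ
8*cross-zero n = begin
  + 8 * cross n 0                                            ≡⟨ cong (+ 8 *_) (cross-zero n) ⟩
  + 8 * (c + p)                                              ≡⟨ scale c p ⟩
  + 4 * (+ 2 * c + + 2 * p)                                  ≡⟨ cong (+ 4 *_) (central-suc-split n) ⟨
  + 4 * C′                                                   ≡⟨ collect C′ (central (+ n)) T ⟩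
  + 2 * C′ + + 8 * central (+ n) * 0ℤ - (+ 4 * T - + 2 * C′) + + 4 * T
                                                             ≡⟨ cong₂ (λ x t → + 2 * C′ + + 8 * central (+ n) * 0ℤ - x + + 4 * t)
                                                                      (conv-one n) (conv-zero n) ⟨
  rhs (+ n) 1ℤ                                               ∎
  where
  c = evenRow n 0ℤ
  p = evenRow n -1ℤ
  C′ = central (+ n + 1ℤ)
  T = centralConv n
  scale : ∀ c p → + 8 * (c + p) ≡ + 4 * (+ 2 * c + + 2 * p)
  scale = solve-∀
  collect : ∀ C′ c T → + 4 * C′ ≡ + 2 * C′ + + 8 * c * 0ℤ - (+ 4 * T - + 2 * C′) + + 4 * T
  collect = solve-∀

8*cross≡rhs : ∀ k n → + 8 * cross n k ≡ rhs (+ n) (+ suc k)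
8*cross≡rhs zero    n = 8*cross-zero n
8*cross≡rhs (suc k) n = begin
  + 8 * cross n (suc k)                                      ≡⟨ split (cross (suc n) k) (cross n (suc k)) ⟩
  + 8 * cross (suc n) k - + 8 * (cross (suc n) k - cross n (suc k))
                                                             ≡⟨ cong₂ (λ a b → a - + 8 * b) (8*cross≡rhs k (suc n)) (cross-diagonal n k) ⟩
  rhs (+ suc n) (+ suc k) - + 8 * D                          ≡⟨ cong (λ N → rhs N (+ suc k) - + 8 * D) (pos-suc n) ⟩
  rhs (+ n + 1ℤ) (+ suc k) - + 8 * D                         ≡⟨ cong (_- + 8 * D) (rhs-diagonal (+ n) (+ suc k)) ⟩
  rhs (+ n) (+ suc k + 1ℤ) + diagonalCorrection (+ n) (+ suc k) - + 8 * D
                                                             ≡⟨ cong (λ d → rhs (+ n) (+ suc k + 1ℤ) + d - + 8 * D)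
                                                                     (diagonalCorrection≡8*crossBoundary n k) ⟩
  rhs (+ n) (+ suc k + 1ℤ) + + 8 * D - + 8 * D               ≡⟨ cancel (rhs (+ n) (+ suc k + 1ℤ)) (+ 8 * D) ⟩
  rhs (+ n) (+ suc k + 1ℤ)                                   ≡⟨ cong (rhs (+ n)) (pos-suc (suc k)) ⟨
  rhs (+ n) (+ suc (suc k))                                  ∎
  where
  D = crossBoundary n k
  split : ∀ a b → + 8 * b ≡ + 8 * a - + 8 * (a - b)
  split = solve-∀
  cancel : ∀ a b → a + b - b ≡ a
  cancel = solve-∀

m*rhs-expand : ∀ n m → + m * rhs (+ n) (+ m)
  ≡ + 2 * + m * binom (+ 2 * + n + + 2 * + m) (+ n + + m)
    + + 8 * + m * binom (+ 2 * + n) (+ n) * binom (+ 2 * + m - + 2) (+ m - + 2)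
    - + m * sumZ (+ 0) (+ n - + m + + 1) (λ l →
        binom (+ 2 * + n - + 2 * l) (+ n - l) * binom (+ 2 * + m + + 2 * l) (+ m + l))
    + + 4 * + m * sumZ (+ 0) (+ n - + m + + 2) (λ l →
        binom (+ 2 * + n - + 2 * l) (+ n - l) * binom (+ 2 * + m + + 2 * l - + 2) (+ m + l - + 1))
m*rhs-expand n m = begin
  + m * rhs (+ n) (+ m)
    ≡⟨ distribute (+ m) (central (+ n + + m)) (central (+ n)) (nearCentral (+ m - 1ℤ)) (conv (+ n) (+ m)) (conv (+ n) (+ m - 1ℤ)) ⟩
  + 2 * + m * central (+ n + + m) + + 8 * + m * central (+ n) * nearCentral (+ m - 1ℤ) - + m * conv (+ n) (+ m) + + 4 * + m * conv (+ n) (+ m - 1ℤ)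
    ≡⟨ cong₂ (λ x y → + 2 * + m * x + + 8 * + m * central (+ n) * y - + m * conv (+ n) (+ m) + + 4 * + m * conv (+ n) (+ m - 1ℤ))
             (cong (λ t → binom t (+ n + + m)) (double-sum (+ n) (+ m))) (cong₂ binom (near-top (+ m)) (near-bottom (+ m))) ⟩
  _ ≡⟨ cong₂ (λ x y → + 2 * + m * binom (+ 2 * + n + + 2 * + m) (+ n + + m)
                      + + 8 * + m * binom (+ 2 * + n) (+ n) * binom (+ 2 * + m - + 2) (+ m - + 2) - + m * x + + 4 * + m * y)
             (Σ-cong (+ n - + m + + 1) (λ l → cong₂ (λ a b → binom a (+ n - l) * binom b (+ m + l)) (left (+ n) l) (right₁ (+ m) l)))
             (trans (cong (λ L → Σ L (λ l → central (+ n - l) * central (+ m - 1ℤ + l))) (limit (+ n) (+ m)))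
                    (Σ-cong (+ n - + m + + 2) (λ l → cong₂ (λ a b → binom a (+ n - l) * b) (left (+ n) l)
                                                          (cong₂ binom (right₂ (+ m) l) (right₂-bottom (+ m) l))))) ⟩
  _ ∎
  where
  distribute : ∀ m X c ν A B → m * (+ 2 * X + + 8 * c * ν - A + + 4 * B) ≡ + 2 * m * X + + 8 * m * c * ν - m * A + + 4 * m * B
  distribute = solve-∀
  double-sum : ∀ n m → + 2 * (n + m) ≡ + 2 * n + + 2 * m
  double-sum = solve-∀
  near-top : ∀ m → + 2 * (m - 1ℤ) ≡ + 2 * m - + 2
  near-top = solve-∀
  near-bottom : ∀ m → m - 1ℤ - 1ℤ ≡ m - + 2
  near-bottom = solve-∀
  left : ∀ n l → + 2 * (n - l) ≡ + 2 * n - + 2 * l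
  left = solve-∀
  right₁ : ∀ m l → + 2 * (m + l) ≡ + 2 * m + + 2 * l
  right₁ = solve-∀
  limit : ∀ n m → n - (m - 1ℤ) + 1ℤ ≡ n - m + + 2
  limit = solve-∀
  right₂ : ∀ m l → + 2 * (m - 1ℤ + l) ≡ + 2 * m + + 2 * l - + 2
  right₂ = solve-∀
  right₂-bottom : ∀ m l → m - 1ℤ + l ≡ m + l - + 1
  right₂-bottom = solve-∀

lemma2p3 : (n m : ℕ) →
    + 8 * sumZ (+ 0) (+ m + + 1) (λ j → sumZ (+ 0) (j + + 1) (λ i →
        j * binom (+ 2 * + n) (+ n + i) * binom (+ 2 * + m) (+ m + j)))
    ≡ + 2 * + m * binom (+ 2 * + n + + 2 * + m) (+ n + + m)
      + + 8 * + m * binom (+ 2 * + n) (+ n) * binom (+ 2 * + m - + 2) (+ m - + 2)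
      - + m * sumZ (+ 0) (+ n - + m + + 1) (λ l →
          binom (+ 2 * + n - + 2 * l) (+ n - l) * binom (+ 2 * + m + + 2 * l) (+ m + l))
      + + 4 * + m * sumZ (+ 0) (+ n - + m + + 2) (λ l →
          binom (+ 2 * + n - + 2 * l) (+ n - l) * binom (+ 2 * + m + + 2 * l - + 2) (+ m + l - + 1))
lemma2p3 n zero    = sym (m*rhs-expand n 0)
lemma2p3 n (suc k) = begin
  + 8 * _                          ≡⟨ cong (+ 8 *_) (doubleSum≡[1+k]*cross n k) ⟩
  + 8 * (+ suc k * cross n k)      ≡⟨ swap (+ suc k) (cross n k) ⟩
  + suc k * (+ 8 * cross n k)      ≡⟨ cong (+ suc k *_) (8*cross≡rhs k n) ⟩
  + suc k * rhs (+ n) (+ suc k)    ≡⟨ m*rhs-expand n (suc k) ⟩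
  _                                ∎
  where
  swap : ∀ a b → + 8 * (a * b) ≡ a * (+ 8 * b)
  swap = solve-∀
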